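{- Let $R$ be a finite ring and let $r$ be a positive integer. For each nonzero $d\in R$ and each $\ell\subseteq[r]$ let $W_{d,\ell}$ and $V_{d,\ell}$ be unary predicate symbols, and for each nonzero $d\in R$ let $$q_d(x,y):=\bigvee_{\ell\subseteq[r]}\big(W_{d,\ell}(x)\wedge V_{d,\ell}(y)\big).$$ Then for every integer $n\geq1$ and every $M\in\mathrm{Mat}_n(R)$ with $\mathrm{srank}(M)\leq r$, there is a structure $[n]^*$ with domain $[n]$ interpreting the predicates $W_{d,\ell}$ and $V_{d,\ell}$ such that for every nonzero $d\in R$ and all $i,j\in[n]$, $$M_{i,j}=d\iff [n]^*\models q_d(i,j).$$
   Context: For $M\in\mathrm{Mat}_n(R)$, its domain $D$ is the set of nonzero elements of $R$ occurring as entries of $M$. For $d\in D$, the $d$-slice $M(d)$ is the $0/1$ matrix with $(M(d))_{i,j}=1$ iff $M_{i,j}=d$. The set-rank of $M$ is $\mathrm{srank}(M)=\sum_{d\in D}\mathrm{rank}_2 M(d)$, where $\mathrm{rank}_2$ is the rank over the field $\mathbb F_2$. -}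

module Defs where

open import Level using (Level)
open import Data.Bool using (Bool; true; false; not; _∧_; _∨_; _xor_; if_then_else_)
open import Data.Nat using (ℕ; zero; suc; _+_; _⊔_)
open import Data.Fin using (Fin)
open import Data.Fin.Subset using (Subset)
open import Data.List using (List; []; _∷_; map; foldr; _++_; allFin)
open import Data.List.Relation.Unary.Any using (Any)
open import Data.List.Relation.Unary.AllPairs using (AllPairs)
open import Data.Vec using (Vec; []; _∷_; lookup; count)
open import Algebra.Bundles using (Ring)
open import Relation.Nullary using (¬_; Dec; does)
open import Relation.Binary using (Decidable)

record FiniteRing (c ℓ : Level) : Set (Level.suc (c Level.⊔ ℓ)) where
  field
    ring     : Ring c ℓ
  open Ring ring public
  field
    _≈?_     : Decidable _≈_
    elements : List Carrier
    complete : ∀ x → Any (x ≈_) elements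
    distinct : AllPairs (λ a b → ¬ (a ≈ b)) elements

-- Linear algebra over 𝔽₂ = Bool (addition = xor) for 0/1 matrices.

Mat₂ : ℕ → Set
Mat₂ n = Fin n → Fin n → Bool

subsets : (n : ℕ) → List (Subset n)
subsets zero    = [] ∷ []
subsets (suc n) = map (false ∷_) (subsets n) ++ map (true ∷_) (subsets n)

allF : {n : ℕ} → (Fin n → Bool) → Bool
allF {n} p = foldr (λ i b → p i ∧ b) true (allFin n)

anyF : {n : ℕ} → (Fin n → Bool) → Bool
anyF {n} p = foldr (λ i b → p i ∨ b) false (allFin n)

allL : {A : Set} → (A → Bool) → List A → Bool
allL p = foldr (λ a b → p a ∧ b) true

rowSum : {n : ℕ} → Mat₂ n → Subset n → Fin n → Bool
rowSum {n} M T j = foldr (λ i b → (lookup T i ∧ M i j) xor b) false (allFin n)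

_⊆ᵇ_ : {n : ℕ} → Subset n → Subset n → Bool
T ⊆ᵇ S = allF (λ i → not (lookup T i) ∨ lookup S i)

-- the rows indexed by S are linearly independent over 𝔽₂:
-- no nonempty subfamily sums to the zero vector
independent : {n : ℕ} → Mat₂ n → Subset n → Bool
independent {n} M S =
  allL (λ T → not ((T ⊆ᵇ S) ∧ anyF (lookup T)) ∨ anyF (rowSum M T)) (subsets n)

size : {n : ℕ} → Subset n → ℕ
size S = count (λ b → Data.Bool._≟_ b true) S

rank₂ : {n : ℕ} → Mat₂ n → ℕ
rank₂ {n} M =
  foldr (λ S m → (if independent M S then size S else 0) ⊔ m) 0 (subsets n)

module _ {c ℓ : Level} (R : FiniteRing c ℓ) where
  open FiniteRing R using (Carrier; _≈?_; 0#; elements)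

  Mat : ℕ → Set c
  Mat n = Fin n → Fin n → Carrier

  slice : {n : ℕ} → Mat n → Carrier → Mat₂ n
  slice M d i j = does (M i j ≈? d)

  inDomain : {n : ℕ} → Mat n → Carrier → Bool
  inDomain M d = not (does (d ≈? 0#)) ∧ anyF (λ i → anyF (λ j → does (M i j ≈? d)))

  srank : {n : ℕ} → Mat n → ℕ
  srank M = foldr (λ d s → (if inDomain M d then rank₂ (slice M d) else 0) + s) 0 elements

{-# OPTIONS --safe #-}
module Submission where

-- A 0/1 matrix N of 𝔽₂-rank at most r has an independent family S of at most r rows spanning
-- all rows, so row i is the sum of a subfamily of S, which can be coded by some l ⊆ [r]. With
-- code i := l and V l := the row that l codes, N i j = 1 iff some l has code i = l and V l j = 1,
-- so W l i := (code i = l) works. Apply this to every slice M(d): its rank is one summand of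
-- srank M ≤ r. A nonzero d that is not an entry of M gets empty predicates.

open import Defs
open import Level using (Level)
open import Function.Base using (_∘_; id)
open import Function.Bundles using (_⇔_; mk⇔; Equivalence)
open import Function.Construct.Composition using (_⇔-∘_)
import Data.Bool
open import Data.Bool using (Bool; true; false; not; _∧_; _∨_; _xor_; if_then_else_; T)
open import Data.Bool.Properties using (T-≡; T-not-≡; T-∧; ¬-not; xor-identityʳ; xor-∧-commutativeRing)
open import Data.Nat using (ℕ; zero; suc; _≤_; _>_; _+_; _⊔_; z≤n)
open import Data.Nat.Properties using (<⇒≱; ≤-trans; m≤m⊔n; m≤n⊔m; ⊔-sel; m≤m+n; m≤n+m; ≤-reflexive)
open import Data.Fin using (Fin; zero; suc)
open import Data.Fin.Subset using (Subset; _∈_; _⊆_; _∉_; _⊂_; Nonempty; ⊥; ⁅_⁆; _∪_; _─_; _-_; ∣_∣)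
open import Data.Fin.Subset.Properties
  using (p─⊥≡p; ∉⊥; drop-∷-⊆; _∈?_; x∈⁅x⁆; x∈⁅y⁆⇒x≡y; q⊆p∪q; x∈p∪q⁺; x∈p∪q⁻; p⊂q⇒∣p∣<∣q∣; p─q⊆p)
open import Data.Vec using ([]; _∷_; lookup; here; there; truncate; padRight)
open import Data.Vec.Properties using (≡-dec; []=⇒lookup; lookup⇒[]=; truncate-padRight)
open import Data.List using (List; []; _∷_; foldr; map; allFin)
open import Data.List.Properties using (foldr-map; map-tabulate)
open import Data.List.Relation.Unary.Any as Any using (satisfied)
open import Data.List.Relation.Unary.Any.Properties using (any⁺; any⁻)
open import Data.List.Relation.Unary.All as All using (All)
open import Data.List.Relation.Unary.All.Properties using (all⁺; all⁻; ¬All⇒Any¬)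
open import Data.List.Membership.Propositional using (lose; find) renaming (_∈_ to _∈ₗ_)
open import Data.List.Membership.Propositional.Properties using (∈-allFin; ∈-map⁺; ∈-++⁺ˡ; ∈-++⁺ʳ)
open import Data.Product using (Σ; ∃; _×_; _,_; proj₁; proj₂)
open import Data.Sum using (inj₁; inj₂)
open import Relation.Nullary using (¬_; Dec; yes; no; contradiction)
open import Relation.Nullary.Decidable using (decidable-stable; T?; does; dec-true; dec-false)
open import Data.Empty using (⊥-elim)
open import Relation.Binary.PropositionalEquality
open import Relation.Binary.Definitions using (DecidableEquality)
open import Algebra.Bundles using (CommutativeRing)
open import Algebra.Properties.CommutativeSemigroup
  (CommutativeRing.+-commutativeSemigroup xor-∧-commutativeRing) using (x∙yz≈y∙xz)

private
  variable
    a : Level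
    A : Set a
    m n : ℕ

foldr-allFin-suc : {B : Set} (f : Fin (suc m) → B → B) (e : B) →
  foldr f e (allFin (suc m)) ≡ f zero (foldr (f ∘ suc) e (allFin m))
foldr-allFin-suc {m} f e =
  cong (f zero) (trans (cong (foldr f e) (sym (map-tabulate id suc))) (foldr-map f suc e (allFin m)))

allL⇔All : (p : A → Bool) (xs : List A) → T (allL p xs) ⇔ All (T ∘ p) xs
allL⇔All p xs rewrite sym (foldr-map _∧_ p true xs) = mk⇔ (all⁺ p xs) (all⁻ p)

allF⇔ : (p : Fin n → Bool) → T (allF p) ⇔ (∀ i → T (p i))
allF⇔ {n} p = mk⇔ (λ t i → All.lookup (Equivalence.to (allL⇔All p (allFin n)) t) (∈-allFin i))
                   (λ h → Equivalence.from (allL⇔All p (allFin n)) (All.tabulate λ {i} _ → h i))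

anyF⇔ : (p : Fin n → Bool) → T (anyF p) ⇔ ∃ λ i → T (p i)
anyF⇔ {n} p rewrite sym (foldr-map _∨_ p false (allFin n)) =
  mk⇔ (satisfied ∘ any⁻ p (allFin n)) (λ (i , t) → any⁺ p (lose (∈-allFin i) t))

f≤foldr-⊔ : (f : A → ℕ) {x : A} {xs : List A} → x ∈ₗ xs → f x ≤ foldr (λ y k → f y ⊔ k) 0 xs
f≤foldr-⊔ f {xs = y ∷ ys} (Any.here refl) = m≤m⊔n (f y) _
f≤foldr-⊔ f {xs = y ∷ ys} (Any.there x∈ys) = ≤-trans (f≤foldr-⊔ f x∈ys) (m≤n⊔m (f y) _)

foldr-⊔-attained : (f : A → ℕ) (x₀ : A) (xs : List A) → ∃ λ x → foldr (λ y k → f y ⊔ k) 0 xs ≤ f x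
foldr-⊔-attained f x₀ [] = x₀ , z≤n
foldr-⊔-attained f x₀ (y ∷ ys) with ⊔-sel (f y) (foldr (λ y k → f y ⊔ k) 0 ys)
... | inj₁ max≡fy = y , ≤-reflexive max≡fy
... | inj₂ max≡rest =
  let x , rest≤fx = foldr-⊔-attained f x₀ ys in x , ≤-trans (≤-reflexive max≡rest) rest≤fx

f≤foldr-+ : (f : A → ℕ) {x : A} {xs : List A} → x ∈ₗ xs → f x ≤ foldr (λ y s → f y + s) 0 xs
f≤foldr-+ f {xs = y ∷ ys} (Any.here refl) = m≤m+n (f y) _
f≤foldr-+ f {xs = y ∷ ys} (Any.there x∈ys) = ≤-trans (f≤foldr-+ f x∈ys) (m≤n+m _ (f y))

∈-subsets : (p : Subset n) → p ∈ₗ subsets n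
∈-subsets [] = Any.here refl
∈-subsets {suc n} (false ∷ p) = ∈-++⁺ˡ (∈-map⁺ (false ∷_) (∈-subsets p))
∈-subsets {suc n} (true ∷ p) = ∈-++⁺ʳ (map (false ∷_) (subsets n)) (∈-map⁺ (true ∷_) (∈-subsets p))

T-not-∨⇔→ : (a b : Bool) → T (not a ∨ b) ⇔ (T a → T b)
T-not-∨⇔→ true b = mk⇔ (λ t _ → t) (λ f → f _)
T-not-∨⇔→ false b = mk⇔ (λ _ ()) (λ _ → _)

¬T-not-∨ : (a b : Bool) → ¬ T (not a ∨ b) → T a × ¬ T b
¬T-not-∨ true b ¬t = _ , ¬t
¬T-not-∨ false b ¬t = ⊥-elim (¬t _)

∈⇔T-lookup : {x : Fin n} {p : Subset n} → x ∈ p ⇔ T (lookup p x)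
∈⇔T-lookup {x = x} {p} =
  mk⇔ (Equivalence.from T-≡ ∘ []=⇒lookup) (lookup⇒[]= x p ∘ Equivalence.to T-≡)

⊆ᵇ⇔⊆ : (p q : Subset n) → T (p ⊆ᵇ q) ⇔ p ⊆ q
⊆ᵇ⇔⊆ p q = mk⇔
  (λ t {x} x∈p → Equivalence.from ∈⇔T-lookup
     (Equivalence.to (T-not-∨⇔→ _ _) (Equivalence.to (allF⇔ _) t x) (Equivalence.to ∈⇔T-lookup x∈p)))
  (λ p⊆q → Equivalence.from (allF⇔ _) λ i → Equivalence.from (T-not-∨⇔→ _ _)
     (Equivalence.to ∈⇔T-lookup ∘ p⊆q {i} ∘ Equivalence.from ∈⇔T-lookup))

anyF-lookup⇔Nonempty : (p : Subset n) → T (anyF (lookup p)) ⇔ Nonempty p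
anyF-lookup⇔Nonempty p = mk⇔
  (λ t → let x , tx = Equivalence.to (anyF⇔ (lookup p)) t in x , Equivalence.from ∈⇔T-lookup tx)
  (λ (x , x∈p) → Equivalence.from (anyF⇔ (lookup p)) (x , Equivalence.to ∈⇔T-lookup x∈p))

-- rowSum N p j is definitionally sumOver p (λ k → N k j); unlike rowSum, sumOver does not tie
-- the number of rows to the length of a row, so it can be analysed by induction on the rows.
sumOver : Subset m → (Fin m → Bool) → Bool
sumOver {m} p φ = foldr (λ i b → (lookup p i ∧ φ i) xor b) false (allFin m)

sumOver-∷ : (b : Bool) (p : Subset m) (φ : Fin (suc m) → Bool) →
  sumOver (b ∷ p) φ ≡ (b ∧ φ zero) xor sumOver p (φ ∘ suc)
sumOver-∷ b p φ = foldr-allFin-suc (λ i s → (lookup (b ∷ p) i ∧ φ i) xor s) false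

sumOver-⊥ : (φ : Fin m → Bool) → sumOver ⊥ φ ≡ false
sumOver-⊥ {zero} φ = refl
sumOver-⊥ {suc m} φ = trans (sumOver-∷ false ⊥ φ) (sumOver-⊥ (φ ∘ suc))

sumOver-⁅⁆ : (i : Fin m) (φ : Fin m → Bool) → sumOver ⁅ i ⁆ φ ≡ φ i
sumOver-⁅⁆ zero φ = begin
  sumOver ⁅ zero ⁆ φ          ≡⟨ sumOver-∷ true ⊥ φ ⟩
  φ zero xor sumOver ⊥ (φ ∘ suc) ≡⟨ cong (φ zero xor_) (sumOver-⊥ (φ ∘ suc)) ⟩
  φ zero xor false            ≡⟨ xor-identityʳ (φ zero) ⟩
  φ zero                      ∎
  where open ≡-Reasoning
sumOver-⁅⁆ (suc i) φ = trans (sumOver-∷ false ⁅ i ⁆ φ) (sumOver-⁅⁆ i (φ ∘ suc))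

sumOver-remove : {i : Fin m} {p : Subset m} (φ : Fin m → Bool) → i ∈ p →
  sumOver p φ ≡ φ i xor sumOver (p - i) φ
sumOver-remove {p = true ∷ p} φ here = begin
  sumOver (true ∷ p) φ              ≡⟨ sumOver-∷ true p φ ⟩
  φ zero xor sumOver p (φ ∘ suc)     ≡⟨ cong (λ q → φ zero xor sumOver q (φ ∘ suc)) (sym (p─⊥≡p p)) ⟩
  φ zero xor sumOver (p ─ ⊥) (φ ∘ suc) ≡⟨ cong (φ zero xor_) (sym (sumOver-∷ false (p ─ ⊥) φ)) ⟩
  φ zero xor sumOver ((true ∷ p) - zero) φ ∎
  where open ≡-Reasoning
sumOver-remove {i = suc i} {p = b ∷ p} φ (there i∈p) = begin
  sumOver (b ∷ p) φ                          ≡⟨ sumOver-∷ b p φ ⟩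
  x xor sumOver p (φ ∘ suc)                  ≡⟨ cong (x xor_) (sumOver-remove (φ ∘ suc) i∈p) ⟩
  x xor (φ (suc i) xor sumOver (p - i) (φ ∘ suc)) ≡⟨ x∙yz≈y∙xz x (φ (suc i)) _ ⟩
  φ (suc i) xor (x xor sumOver (p - i) (φ ∘ suc)) ≡⟨ cong (φ (suc i) xor_) (sym (sumOver-∷ b (p - i) φ)) ⟩
  φ (suc i) xor sumOver ((b ∷ p) - suc i) φ  ∎
  where
  open ≡-Reasoning
  x = b ∧ φ zero

x∉p-x : (p : Subset n) (x : Fin n) → x ∉ p - x
x∉p-x (_ ∷ p) (suc x) (there x∈p-x) = x∉p-x p x x∈p-x

xor≡false⇒≡ : (a b : Bool) → a xor b ≡ false → a ≡ b
xor≡false⇒≡ false false _ = refl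
xor≡false⇒≡ true true _ = refl

does≡true⇒ : {P : Set a} (P? : Dec P) → does P? ≡ true → P
does≡true⇒ (yes p) _ = p

¬T⇒≡false : {b : Bool} → ¬ T b → b ≡ false
¬T⇒≡false ¬t = ¬-not (¬t ∘ Equivalence.from T-≡)

Dependent : Mat₂ n → Subset n → Set
Dependent N S = ∃ λ p → p ⊆ S × Nonempty p × ∀ j → rowSum N p j ≡ false

independent⇒¬Dependent : (N : Mat₂ n) (S : Subset n) → T (independent N S) → ¬ Dependent N S
independent⇒¬Dependent {n} N S ind (p , p⊆S , p≢∅ , p↦0) =
  let j , tj = Equivalence.to (anyF⇔ (rowSum N p)) nonzero
  in subst T (p↦0 j) tj
  where
  nonzero : T (anyF (rowSum N p))
  nonzero = Equivalence.to (T-not-∨⇔→ _ _)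
    (All.lookup (Equivalence.to (allL⇔All _ (subsets n)) ind) (∈-subsets p))
    (Equivalence.from T-∧
       (Equivalence.from (⊆ᵇ⇔⊆ p S) p⊆S , Equivalence.from (anyF-lookup⇔Nonempty p) p≢∅))

¬independent⇒Dependent : (N : Mat₂ n) (S : Subset n) → ¬ T (independent N S) → Dependent N S
¬independent⇒Dependent {n} N S ¬ind =
  let p , ¬tp = satisfied
        (¬All⇒Any¬ (λ _ → T? _) (subsets n) (¬ind ∘ Equivalence.from (allL⇔All _ (subsets n))))
      t[p⊆S∧p≢∅] , ¬t[Σp≢0] = ¬T-not-∨ _ _ ¬tp
      t[p⊆S] , t[p≢∅] = Equivalence.to T-∧ t[p⊆S∧p≢∅]
  in p , Equivalence.to (⊆ᵇ⇔⊆ p S) t[p⊆S] , Equivalence.to (anyF-lookup⇔Nonempty p) t[p≢∅] ,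
     λ j → ¬T⇒≡false (¬t[Σp≢0] ∘ λ t → Equivalence.from (anyF⇔ (rowSum N p)) (j , t))

⊥-independent : (N : Mat₂ n) → T (independent N ⊥)
⊥-independent N = decidable-stable (T? _) λ ¬ind →
  let _ , p⊆⊥ , (_ , x∈p) , _ = ¬independent⇒Dependent N ⊥ ¬ind in ∉⊥ (p⊆⊥ x∈p)

independent⇒∣S∣≤rank₂ : (N : Mat₂ n) (S : Subset n) → T (independent N S) → ∣ S ∣ ≤ rank₂ N
independent⇒∣S∣≤rank₂ N S ind =
  subst (_≤ rank₂ N) (cong (if_then ∣ S ∣ else 0) (Equivalence.to T-≡ ind))
        (f≤foldr-⊔ (λ S → if independent N S then size S else 0) (∈-subsets S))

rank₂-attained : (N : Mat₂ n) → ∃ λ S → T (independent N S) × rank₂ N ≤ ∣ S ∣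
rank₂-attained {n} N with foldr-⊔-attained (λ S → if independent N S then size S else 0) ⊥ (subsets n)
... | S , rank≤ with independent N S in ind
...   | true = S , Equivalence.from T-≡ ind , rank≤
...   | false = ⊥ , ⊥-independent N , ≤-trans rank≤ z≤n

-- Adjoining a row i ∉ S to a maximum independent S yields a zero-sum family, which must contain i.
row∈span : (N : Mat₂ n) (S : Subset n) → T (independent N S) → rank₂ N ≤ ∣ S ∣ →
  ∀ i → ∃ λ p → p ⊆ S × ∀ j → N i j ≡ rowSum N p j
row∈span N S ind rank≤∣S∣ i with i ∈? S
... | yes i∈S = ⁅ i ⁆ , (λ x∈⁅i⁆ → subst (_∈ S) (sym (x∈⁅y⁆⇒x≡y i x∈⁅i⁆)) i∈S) ,
                λ j → sym (sumOver-⁅⁆ i (λ k → N k j))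
... | no i∉S with ¬independent⇒Dependent N (⁅ i ⁆ ∪ S) S∪i-dependent
  where
  S⊂⁅i⁆∪S : S ⊂ ⁅ i ⁆ ∪ S
  S⊂⁅i⁆∪S = q⊆p∪q ⁅ i ⁆ S , i , x∈p∪q⁺ (inj₁ (x∈⁅x⁆ i)) , i∉S
  S∪i-dependent : ¬ T (independent N (⁅ i ⁆ ∪ S))
  S∪i-dependent ind′ = <⇒≱ (p⊂q⇒∣p∣<∣q∣ S⊂⁅i⁆∪S)
                           (≤-trans (independent⇒∣S∣≤rank₂ N (⁅ i ⁆ ∪ S) ind′) rank≤∣S∣)
...   | p , p⊆⁅i⁆∪S , p≢∅ , p↦0 with i ∈? p
...     | no i∉p = ⊥-elim (independent⇒¬Dependent N S ind (p , p⊆S , p≢∅ , p↦0))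
  where
  p⊆S : p ⊆ S
  p⊆S x∈p with x∈p∪q⁻ ⁅ i ⁆ S (p⊆⁅i⁆∪S x∈p)
  ... | inj₁ x∈⁅i⁆ = ⊥-elim (i∉p (subst (_∈ p) (x∈⁅y⁆⇒x≡y i x∈⁅i⁆) x∈p))
  ... | inj₂ x∈S = x∈S
...     | yes i∈p =
  p - i , p-i⊆S , λ j → xor≡false⇒≡ _ _ (trans (sym (sumOver-remove (λ k → N k j) i∈p)) (p↦0 j))
  where
  p-i⊆S : p - i ⊆ S
  p-i⊆S {x} x∈p-i with x∈p∪q⁻ ⁅ i ⁆ S (p⊆⁅i⁆∪S (p─q⊆p p ⁅ i ⁆ x∈p-i))
  ... | inj₁ x∈⁅i⁆ = ⊥-elim (x∉p-x p i (subst (_∈ p - i) (x∈⁅y⁆⇒x≡y i x∈⁅i⁆) x∈p-i))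
  ... | inj₂ x∈S = x∈S

compress : (S : Subset n) → Subset n → Subset ∣ S ∣
compress [] [] = []
compress (false ∷ S) (_ ∷ p) = compress S p
compress (true ∷ S) (b ∷ p) = b ∷ compress S p

expand : (S : Subset n) → Subset ∣ S ∣ → Subset n
expand [] [] = []
expand (false ∷ S) c = false ∷ expand S c
expand (true ∷ S) (b ∷ c) = b ∷ expand S c

expand-compress : {S p : Subset n} → p ⊆ S → expand S (compress S p) ≡ p
expand-compress {S = []} {[]} _ = refl
expand-compress {S = false ∷ S} {false ∷ p} p⊆S = cong (false ∷_) (expand-compress (drop-∷-⊆ p⊆S))
expand-compress {S = false ∷ S} {true ∷ p} p⊆S with () ← p⊆S here
expand-compress {S = true ∷ S} {b ∷ p} p⊆S = cong (b ∷_) (expand-compress (drop-∷-⊆ p⊆S))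

rank₂≤⇒rows-coded : {r : ℕ} (N : Mat₂ n) → rank₂ N ≤ r →
  ∃ λ (code : Fin n → Subset r) → ∃ λ (row : Subset r → Fin n → Bool) → ∀ i j → N i j ≡ row (code i) j
rank₂≤⇒rows-coded {n} {r} N rank≤r with rank₂-attained N
... | S , ind , rank≤∣S∣ = code , row , N≡row∘code
  where
  ∣S∣≤r : ∣ S ∣ ≤ r
  ∣S∣≤r = ≤-trans (independent⇒∣S∣≤rank₂ N S ind) rank≤r
  span : ∀ i → ∃ λ p → p ⊆ S × ∀ j → N i j ≡ rowSum N p j
  span = row∈span N S ind rank≤∣S∣
  code : Fin n → Subset r
  code i = padRight ∣S∣≤r false (compress S (proj₁ (span i)))
  row : Subset r → Fin n → Bool
  row c = rowSum N (expand S (truncate ∣S∣≤r c))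
  N≡row∘code : ∀ i j → N i j ≡ row (code i) j
  N≡row∘code i j = begin
    N i j                                ≡⟨ N≡Σp j ⟩
    rowSum N p j                         ≡⟨ cong (λ q → rowSum N q j) (sym (expand-compress p⊆S)) ⟩
    rowSum N (expand S (compress S p)) j ≡⟨ cong (λ c → rowSum N (expand S c) j)
                                                  (sym (truncate-padRight ∣S∣≤r false _)) ⟩
    row (code i) j                       ∎
    where
    open ≡-Reasoning
    p = proj₁ (span i)
    p⊆S = proj₁ (proj₂ (span i))
    N≡Σp = proj₂ (proj₂ (span i))

-- N is the union of the combinatorial rectangles W l × V l, l ⊆ [r]; these are the disjuncts of q_d.
Covers : (r : ℕ) → Mat₂ n → (W V : Subset r → Fin n → Bool) → Set
Covers r N W V = ∀ i j → N i j ≡ true ⇔ Σ (Subset r) (λ l → (W l i ≡ true) × (V l j ≡ true))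

rank₂≤⇒Covers : {r : ℕ} (N : Mat₂ n) → rank₂ N ≤ r → ∃ λ W → ∃ λ V → Covers r N W V
rank₂≤⇒Covers {r = r} N rank≤r with rank₂≤⇒rows-coded N rank≤r
... | code , row , N≡row∘code = (λ l i → does (code i ≟ l)) , row , λ i j → mk⇔
  (λ Nij → code i , dec-true (code i ≟ code i) refl , trans (sym (N≡row∘code i j)) Nij)
  (λ (l , code≟l , rowlj) → trans (N≡row∘code i j)
     (subst (λ c → row c j ≡ true) (sym (does≡true⇒ (code i ≟ l) code≟l)) rowlj))
  where
  _≟_ : DecidableEquality (Subset r)
  _≟_ = ≡-dec Data.Bool._≟_

zero-Covers : {r : ℕ} (N : Mat₂ n) → (∀ i j → N i j ≡ false) → Covers r N (λ _ _ → false) (λ _ _ → false)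
zero-Covers N N≡0 i j = mk⇔ (λ Nij → contradiction (trans (sym (N≡0 i j)) Nij) λ ()) λ ()

module _ {c ℓ : Level} (R : FiniteRing c ℓ) {n : ℕ} (M : Mat R n) where
  open FiniteRing R using (Carrier; _≈_; _≈?_; 0#; elements) renaming (trans to ≈-trans; sym to ≈-sym)

  rank₂-slice≤srank : {e : Carrier} → e ∈ₗ elements → inDomain R M e ≡ true →
    rank₂ (slice R M e) ≤ srank R M
  rank₂-slice≤srank {e} e∈ e∈D =
    subst (_≤ srank R M) (cong (if_then rank₂ (slice R M e) else 0) e∈D)
          (f≤foldr-+ (λ d → if inDomain R M d then rank₂ (slice R M d) else 0) e∈)

  slice-empty : {e : Carrier} → ¬ e ≈ 0# → inDomain R M e ≡ false → ∀ i j → slice R M e i j ≡ false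
  slice-empty {e} e≉0 e∉D i j = ¬T⇒≡false λ t[Mij≈e] →
    subst T e∉D (Equivalence.from T-∧
      ( Equivalence.from T-not-≡ (dec-false (e ≈? 0#) e≉0)
      , Equivalence.from (anyF⇔ _) (i , Equivalence.from (anyF⇔ _) (j , t[Mij≈e]))))

  ≈⇔slice : {d e : Carrier} → d ≈ e → ∀ i j → M i j ≈ d ⇔ slice R M e i j ≡ true
  ≈⇔slice {d} {e} d≈e i j = mk⇔ (λ Mij≈d → dec-true (M i j ≈? e) (≈-trans Mij≈d d≈e))
                                 (λ t → ≈-trans (does≡true⇒ (M i j ≈? e) t) (≈-sym d≈e))

  slice-Covers : {r : ℕ} → srank R M ≤ r → {e : Carrier} → e ∈ₗ elements →
    ∃ λ W → ∃ λ V → ¬ e ≈ 0# → Covers r (slice R M e) W V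
  slice-Covers srank≤r {e} e∈ with inDomain R M e in e∈D?
  ... | true = let W , V , cover = rank₂≤⇒Covers _ (≤-trans (rank₂-slice≤srank e∈ e∈D?) srank≤r)
               in W , V , λ _ → cover
  ... | false = _ , _ , λ e≉0 → zero-Covers _ (slice-empty e≉0 e∈D?)

lemma16 : {c ℓ : Level} (R : FiniteRing c ℓ) (r : ℕ) → r > 0 →
    (n : ℕ) → n > 0 → (M : Mat R n) → srank R M ≤ r →
    Σ (FiniteRing.Carrier R → Subset r → Fin n → Bool) λ W →
    Σ (FiniteRing.Carrier R → Subset r → Fin n → Bool) λ V →
    ∀ (d : FiniteRing.Carrier R) → ¬ FiniteRing._≈_ R d (FiniteRing.0# R) →
    ∀ (i j : Fin n) →
    FiniteRing._≈_ R (M i j) d ⇔ Σ (Subset r) (λ l → (W d l i ≡ true) × (V d l j ≡ true))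
lemma16 R r _ n _ M srank≤r =
  (λ d → proj₁ (cover d)) , (λ d → proj₁ (proj₂ (cover d))) , λ d d≉0 i j →
    proj₂ (proj₂ (cover d)) (d≉0 ∘ ≈-trans (d≈rep d)) i j ⇔-∘ ≈⇔slice R M (d≈rep d) i j
  where
  open FiniteRing R using (Carrier; _≈_; 0#; complete) renaming (trans to ≈-trans)
  -- d itself need not occur in elements, only an ≈-equal representative does.
  representative : Carrier → Carrier
  representative d = proj₁ (find (complete d))
  d≈rep : ∀ d → d ≈ representative d
  d≈rep d = proj₂ (proj₂ (find (complete d)))
  cover : ∀ d → ∃ λ W → ∃ λ V → ¬ representative d ≈ 0# → Covers r (slice R M (representative d)) W V
  cover d = slice-Covers R M srank≤r (proj₁ (proj₂ (find (complete d))))
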